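{- For every positive integer $n$, \[\mathcal{I}_n(n)=(n+2)3^{n-2}+2\sum_{k=0}^{n-3}(n-k-2)\,3^{n-k-3}\mathcal{M}_k.\]
   Context: $\mathcal{I}_m(n)$ is the number of sequences $(r_1,\dots,r_n)$ with $r_i\in\{1,\dots,m\}$ and $|r_{i+1}-r_i|\le1$, i.e. the number of lattice paths with steps $(1,0),(1,1),(1,-1)$ from the first column to the last column of the table with $m$ rows and $n$ columns, staying inside the table. $\mathcal{M}_k$ is the $k$-th Motzkin number: the number of lattice paths from $(0,0)$ to $(k,0)$ with steps $(1,1),(1,-1),(1,0)$ never going below the $x$-axis ($\mathcal{M}_0=1$). Empty sums are $0$. -}

module Defs where

open import Data.Nat using (ℕ; zero; suc; _+_; _*_; _∸_; _^_; _≤_; _≤ᵇ_)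
open import Data.Bool using (Bool; true; false; _∧_; if_then_else_)
open import Data.List using (List; []; _∷_; map; concatMap; length; filter; sum; upTo; allFin)
open import Data.Fin using (Fin; toℕ)
open import Data.Integer as ℤ using (ℤ; +_; -[1+_])

seqs : {A : Set} → List A → ℕ → List (List A)
seqs xs zero    = [] ∷ []
seqs xs (suc n) = concatMap (λ x → map (x ∷_) (seqs xs n)) xs

near : ℕ → ℕ → Bool
near a b = (a ≤ᵇ suc b) ∧ (b ≤ᵇ suc a)

adjOK : List ℕ → Bool
adjOK []            = true
adjOK (a ∷ [])      = true
adjOK (a ∷ b ∷ rs)  = near a b ∧ adjOK (b ∷ rs)

count : {A : Set} → (A → Bool) → List A → ℕ
count p []       = 0
count p (x ∷ xs) = if p x then suc (count p xs) else count p xs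

range1 : ℕ → List ℕ
range1 m = map suc (upTo m)

I : ℕ → ℕ → ℕ
I m n = count adjOK (seqs (range1 m) n)

data Step : Set where
  up down flat : Step

steps : List Step
steps = up ∷ down ∷ flat ∷ []

motzOK : ℕ → List Step → Bool
motzOK zero    []          = true
motzOK (suc h) []          = false
motzOK h       (up ∷ s)    = motzOK (suc h) s
motzOK h       (flat ∷ s)  = motzOK h s
motzOK zero    (down ∷ s)  = false
motzOK (suc h) (down ∷ s)  = motzOK h s

Motzkin : ℕ → ℕ
Motzkin k = count (motzOK 0) (seqs steps k)

Σ< : ℕ → (ℕ → ℕ) → ℕ
Σ< zero    f = 0
Σ< (suc N) f = Σ< N f + f N

-- A sequence in the n × n table is a walk with steps −1, 0, +1 confined to rows 1..n.
-- Among the 3^(n−1) unconstrained walks from a given row, none can touch both forbidden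
-- rows 0 and n+1, since they are n+1 apart, so the confined ones are counted by subtracting
-- the walks that touch row 0 and those that touch row n+1 (inclusion–exclusion without
-- an intersection term). A walk that first touches 0 after k+1 steps is a Motzkin path
-- of length k from the starting height − 1 down to 0, followed by an arbitrary tail, so
-- the touching walks are weighted sums of Motzkin numbers; summing over the starting
-- rows turns this into a linear recurrence whose solution is the stated closed form.
module Submission where

open import Data.Bool using (Bool; true; false; _∧_; if_then_else_)
open import Data.List using (List; []; _∷_; _++_; map; concatMap; upTo; applyUpTo)
open import Data.List.Properties using (map-cong; map-∘; map-upTo)
open import Data.Nat using (ℕ; zero; suc; _+_; _*_; _∸_; _^_; _≤_; _<_; _≤ᵇ_; _<ᵇ_; s≤s)
open import Data.Nat.ListAction using (sum)
open import Data.Nat.Properties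
open import Data.Nat.Tactic.RingSolver using (solve-∀)
open import Data.Product using (_,_)
open import Function using (_∘_)
open import Relation.Binary.PropositionalEquality
open ≡-Reasoning

open import Defs

Σ<-cong : ∀ N {f g : ℕ → ℕ} → (∀ k → k < N → f k ≡ g k) → Σ< N f ≡ Σ< N g
Σ<-cong zero    f≡g = refl
Σ<-cong (suc N) f≡g = cong₂ _+_ (Σ<-cong N (λ k k<N → f≡g k (m<n⇒m<1+n k<N))) (f≡g N ≤-refl)

Σ<-front : ∀ N (f : ℕ → ℕ) → Σ< (suc N) f ≡ f 0 + Σ< N (f ∘ suc)
Σ<-front zero    f = +-comm 0 (f 0)
Σ<-front (suc N) f = begin
  Σ< (suc N) f + f (suc N)             ≡⟨ cong (_+ f (suc N)) (Σ<-front N f) ⟩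
  f 0 + Σ< N (f ∘ suc) + f (suc N)     ≡⟨ +-assoc (f 0) _ _ ⟩
  f 0 + Σ< (suc N) (f ∘ suc)           ∎

Σ<-distrib-+ : ∀ N (f g : ℕ → ℕ) → Σ< N (λ k → f k + g k) ≡ Σ< N f + Σ< N g
Σ<-distrib-+ zero    f g = refl
Σ<-distrib-+ (suc N) f g = begin
  Σ< N (λ k → f k + g k) + (f N + g N) ≡⟨ cong (_+ (f N + g N)) (Σ<-distrib-+ N f g) ⟩
  Σ< N f + Σ< N g + (f N + g N)        ≡⟨ +-interchange (Σ< N f) _ _ _ ⟩
  Σ< N f + f N + (Σ< N g + g N)        ∎
  where
  +-interchange : ∀ a b c d → a + b + (c + d) ≡ a + c + (b + d)
  +-interchange = solve-∀

Σ<-const : ∀ N c → Σ< N (λ _ → c) ≡ N * c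
Σ<-const zero    c = refl
Σ<-const (suc N) c = trans (cong (_+ c) (Σ<-const N c)) (+-comm (N * c) c)

Σ<-reverse : ∀ N (f : ℕ → ℕ) → Σ< N (λ i → f (N ∸ i)) ≡ Σ< N (f ∘ suc)
Σ<-reverse zero    f = refl
Σ<-reverse (suc N) f = begin
  Σ< (suc N) (λ i → f (suc N ∸ i))  ≡⟨ Σ<-front N _ ⟩
  f (suc N) + Σ< N (λ i → f (N ∸ i)) ≡⟨ cong (f (suc N) +_) (Σ<-reverse N f) ⟩
  f (suc N) + Σ< N (f ∘ suc)         ≡⟨ +-comm (f (suc N)) _ ⟩
  Σ< (suc N) (f ∘ suc)               ∎

sum-applyUpTo : ∀ N (f : ℕ → ℕ) → sum (applyUpTo f N) ≡ Σ< N f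
sum-applyUpTo zero    f = refl
sum-applyUpTo (suc N) f =
  trans (cong (f 0 +_) (sum-applyUpTo N (f ∘ suc))) (sym (Σ<-front N f))

sum-map-range1 : ∀ m (f : ℕ → ℕ) → sum (map f (range1 m)) ≡ Σ< m (f ∘ suc)
sum-map-range1 m f = begin
  sum (map f (map suc (upTo m)))  ≡⟨ cong sum (sym (map-∘ (upTo m))) ⟩
  sum (map (f ∘ suc) (upTo m))    ≡⟨ cong sum (map-upTo (f ∘ suc) m) ⟩
  sum (applyUpTo (f ∘ suc) m)     ≡⟨ sum-applyUpTo m (f ∘ suc) ⟩
  Σ< m (f ∘ suc)                  ∎

count-++ : {A : Set} (p : A → Bool) (xs ys : List A) →
  count p (xs ++ ys) ≡ count p xs + count p ys
count-++ p []       ys = refl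
count-++ p (x ∷ xs) ys with p x
... | true  = cong suc (count-++ p xs ys)
... | false = count-++ p xs ys

count-map : {A B : Set} (p : B → Bool) (f : A → B) (xs : List A) →
  count p (map f xs) ≡ count (p ∘ f) xs
count-map p f []       = refl
count-map p f (x ∷ xs) with p (f x)
... | true  = cong suc (count-map p f xs)
... | false = count-map p f xs

count-concatMap : {A B : Set} (p : B → Bool) (f : A → List B) (xs : List A) →
  count p (concatMap f xs) ≡ sum (map (count p ∘ f) xs)
count-concatMap p f []       = refl
count-concatMap p f (x ∷ xs) =
  trans (count-++ p (f x) (concatMap f xs)) (cong (count p (f x) +_) (count-concatMap p f xs))

count-false : {A : Set} (xs : List A) → count (λ _ → false) xs ≡ 0
count-false []       = refl
count-false (_ ∷ xs) = count-false xs

count-∧ : {A : Set} (b : Bool) (q : A → Bool) (xs : List A) →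
  count (λ x → b ∧ q x) xs ≡ (if b then count q xs else 0)
count-∧ true  q xs = refl
count-∧ false q xs = count-false xs

count-seqs-suc : {A : Set} (p : List A → Bool) (xs : List A) (n : ℕ) →
  count p (seqs xs (suc n)) ≡ sum (map (λ x → count (p ∘ (x ∷_)) (seqs xs n)) xs)
count-seqs-suc p xs n = trans (count-concatMap p _ xs)
  (cong sum (map-cong (λ x → count-map p (x ∷_) (seqs xs n)) xs))

<ᵇ-suc : ∀ a b → (a <ᵇ suc b) ≡ (a ≤ᵇ b)
<ᵇ-suc zero    b = refl
<ᵇ-suc (suc a) b = refl

near-suc : ∀ a b → near (suc a) (suc b) ≡ near a b
near-suc a b rewrite <ᵇ-suc a (suc b) | <ᵇ-suc b (suc a) = refl

if-zero : ∀ b {x} → x ≡ 0 → (if b then x else 0) ≡ 0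
if-zero true  x≡0 = x≡0
if-zero false x≡0 = refl

window-interior : ∀ i d (g : ℕ → ℕ) →
  Σ< (3 + i + d) (λ j → if near (suc i) j then g j else 0) ≡ g i + g (suc i) + g (suc (suc i))
window-interior zero d g = begin
  Σ< (3 + d) f                                ≡⟨ Σ<-front (2 + d) f ⟩
  g 0 + Σ< (2 + d) (f ∘ suc)                  ≡⟨ cong (g 0 +_) (Σ<-front (1 + d) _) ⟩
  g 0 + (g 1 + Σ< (1 + d) (f ∘ suc ∘ suc))    ≡⟨ cong (λ z → g 0 + (g 1 + z)) (Σ<-front d _) ⟩
  g 0 + (g 1 + (g 2 + Σ< d (λ _ → 0)))        ≡⟨ cong (λ z → g 0 + (g 1 + (g 2 + z))) (trans (Σ<-const d 0) (*-zeroʳ d)) ⟩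
  g 0 + (g 1 + (g 2 + 0))                     ≡⟨ rearrange (g 0) (g 1) (g 2) ⟩
  g 0 + g 1 + g 2                             ∎
  where
  f : ℕ → ℕ
  f j = if near 1 j then g j else 0
  rearrange : ∀ x y z → x + (y + (z + 0)) ≡ x + y + z
  rearrange = solve-∀
window-interior (suc i) d g = begin
  Σ< (suc (3 + i + d)) (λ j → if near (suc (suc i)) j then g j else 0)
    ≡⟨ Σ<-front (3 + i + d) _ ⟩
  Σ< (3 + i + d) (λ j → if near (suc (suc i)) (suc j) then g (suc j) else 0)
    ≡⟨ Σ<-cong (3 + i + d) (λ j _ → cong (λ b → if b then g (suc j) else 0) (near-suc (suc i) j)) ⟩
  Σ< (3 + i + d) (λ j → if near (suc i) j then g (suc j) else 0)
    ≡⟨ window-interior i d (g ∘ suc) ⟩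
  g (suc i) + g (suc (suc i)) + g (suc (suc (suc i))) ∎

-- At the bottom and top rows the missing neighbour is supplied by the zero values g 0 and g (m+1).
window : ∀ {m} i (g : ℕ → ℕ) → i < m → g 0 ≡ 0 → g (suc m) ≡ 0 →
  Σ< m (λ j → if near i j then g (suc j) else 0) ≡ g i + g (suc i) + g (suc (suc i))
window {m} i g i<m g0≡0 gm≡0 with m≤n⇒∃[o]m+o≡n i<m
... | d , refl = begin
  Σ< m (λ j → if near i j then g (suc j) else 0)
    ≡⟨ Σ<-cong m (λ j _ → cong (λ b → if b then g (suc j) else 0) (sym (near-suc i j))) ⟩
  Σ< m (f ∘ suc)
    ≡⟨ sym (+-identityʳ _) ⟩
  0 + Σ< m (f ∘ suc) + 0
    ≡⟨ sym (cong₂ (λ x y → x + Σ< m (f ∘ suc) + y) (if-zero (near (suc i) 0) g0≡0) (if-zero (near (suc i) (suc m)) gm≡0)) ⟩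
  f 0 + Σ< m (f ∘ suc) + f (suc m)
    ≡⟨ cong (_+ f (suc m)) (sym (Σ<-front m f)) ⟩
  Σ< (3 + i + d) f
    ≡⟨ window-interior i d g ⟩
  g i + g (suc i) + g (suc (suc i)) ∎
  where
  f : ℕ → ℕ
  f j = if near (suc i) j then g j else 0

-- Walks of length L from height x that reach height 0; from there on every continuation counts.
hits : ℕ → ℕ → ℕ
hits L zero          = 3 ^ L
hits zero    (suc x) = 0
hits (suc L) (suc x) = hits L x + hits L (suc x) + hits L (suc (suc x))

hits-vanish : ∀ {L x} → L < x → hits L x ≡ 0
hits-vanish {zero}  {suc x} _         = refl
hits-vanish {suc L} {suc x} (s≤s L<x)
  rewrite hits-vanish L<x | hits-vanish (m<n⇒m<1+n L<x) | hits-vanish (m<n⇒m<1+n (m<n⇒m<1+n L<x)) = refl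

-- Walks of length L that avoid two forbidden rows lying a steps below and b steps above the start.
confined : ℕ → ℕ → ℕ → ℕ
confined L       zero    b       = 0
confined L       (suc a) zero    = 0
confined zero    (suc a) (suc b) = 1
confined (suc L) (suc a) (suc b) =
  confined L a (suc (suc b)) + confined L (suc a) (suc b) + confined L (suc (suc a)) b

-- Since L < a + b, no walk of length L reaches both forbidden rows.
confined+hits+hits : ∀ L a b → L < a + b → confined L a b + hits L a + hits L b ≡ 3 ^ L
confined+hits+hits L zero b L<b =
  trans (cong (3 ^ L +_) (hits-vanish L<b)) (+-identityʳ (3 ^ L))
confined+hits+hits L (suc a) zero L<a =
  cong (_+ 3 ^ L) (hits-vanish (subst (L <_) (+-identityʳ (suc a)) L<a))
confined+hits+hits zero (suc a) (suc b) _ = refl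
confined+hits+hits (suc L) (suc a) (suc b) sL<s = begin
  c₁ + c₂ + c₃ + (hits L a + hits L (suc a) + hits L (suc (suc a)))
              + (hits L b + hits L (suc b) + hits L (suc (suc b)))
    ≡⟨ regroup c₁ c₂ c₃ _ _ _ _ _ _ ⟩
  (c₁ + hits L a + hits L (suc (suc b))) + (c₂ + hits L (suc a) + hits L (suc b))
              + (c₃ + hits L (suc (suc a)) + hits L b)
    ≡⟨ cong₂ _+_ (cong₂ _+_ (confined+hits+hits L a (suc (suc b)) (L<s (+-suc a (suc b))))
                            (confined+hits+hits L (suc a) (suc b) (L<s refl)))
                 (confined+hits+hits L (suc (suc a)) b (L<s (sym (+-suc (suc a) b)))) ⟩
  3 ^ L + 3 ^ L + 3 ^ L
    ≡⟨ triple (3 ^ L) ⟩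
  3 * 3 ^ L ∎
  where
  c₁ = confined L a (suc (suc b))
  c₂ = confined L (suc a) (suc b)
  c₃ = confined L (suc (suc a)) b
  L<s : ∀ {x} → x ≡ suc a + suc b → L < x
  L<s x≡s = subst (L <_) (sym x≡s) (<-trans (n<1+n L) sL<s)
  regroup : ∀ c₁ c₂ c₃ x₁ x₂ x₃ y₁ y₂ y₃ →
    c₁ + c₂ + c₃ + (x₁ + x₂ + x₃) + (y₁ + y₂ + y₃) ≡ (c₁ + x₁ + y₃) + (c₂ + x₂ + y₂) + (c₃ + x₃ + y₁)
  regroup = solve-∀
  triple : ∀ p → p + p + p ≡ 3 * p
  triple = solve-∀

inStrip : ℕ → ℕ → ℕ → ℕ
inStrip m L r = confined L r (suc m ∸ r)

inStrip-suc : ∀ {m} L i → i < m →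
  inStrip m (suc L) (suc i) ≡ inStrip m L i + inStrip m L (suc i) + inStrip m L (suc (suc i))
inStrip-suc {m} L i i<m = begin
  confined (suc L) (suc i) (m ∸ i)
    ≡⟨ cong (confined (suc L) (suc i)) gap ⟩
  confined L i (suc (suc b)) + confined L (suc i) (suc b) + confined L (suc (suc i)) b
    ≡⟨ cong₂ (λ x y → confined L i x + confined L (suc i) y + confined L (suc (suc i)) b)
             (sym (trans (+-∸-assoc 1 (<⇒≤ i<m)) (cong suc gap))) (sym gap) ⟩
  inStrip m L i + inStrip m L (suc i) + inStrip m L (suc (suc i)) ∎
  where
  b = m ∸ suc i
  gap : m ∸ i ≡ suc b
  gap = +-∸-assoc 1 i<m

extensions : List ℕ → ℕ → ℕ → ℕ
extensions xs L x = count (λ s → adjOK (x ∷ s)) (seqs xs L)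

extensions-suc : ∀ xs L x →
  extensions xs (suc L) x ≡ sum (map (λ y → if near x y then extensions xs L y else 0) xs)
extensions-suc xs L x = trans (count-seqs-suc (λ s → adjOK (x ∷ s)) xs L)
  (cong sum (map-cong (λ y → count-∧ (near x y) (λ s → adjOK (y ∷ s)) (seqs xs L)) xs))

extensions≡inStrip : ∀ {m} L i → i < m → extensions (range1 m) L (suc i) ≡ inStrip m L (suc i)
extensions≡inStrip {m} zero i i<m = sym (cong (confined 0 (suc i)) (+-∸-assoc 1 i<m))
extensions≡inStrip {m} (suc L) i i<m = begin
  extensions (range1 m) (suc L) (suc i)
    ≡⟨ extensions-suc (range1 m) L (suc i) ⟩
  sum (map (λ y → if near (suc i) y then extensions (range1 m) L y else 0) (range1 m))
    ≡⟨ sum-map-range1 m _ ⟩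
  Σ< m (λ j → if near (suc i) (suc j) then extensions (range1 m) L (suc j) else 0)
    ≡⟨ Σ<-cong m (λ j j<m → cong₂ (λ b x → if b then x else 0) (near-suc i j) (extensions≡inStrip L j j<m)) ⟩
  Σ< m (λ j → if near i j then inStrip m L (suc j) else 0)
    ≡⟨ window i (inStrip m L) i<m refl (cong (confined L (suc m)) (n∸n≡0 m)) ⟩
  inStrip m L i + inStrip m L (suc i) + inStrip m L (suc (suc i))
    ≡⟨ sym (inStrip-suc L i i<m) ⟩
  inStrip m (suc L) (suc i) ∎

I≡Σ<-inStrip : ∀ m L → I m (suc L) ≡ Σ< m (λ i → inStrip m L (suc i))
I≡Σ<-inStrip m L = begin
  count adjOK (seqs (range1 m) (suc L))              ≡⟨ count-seqs-suc adjOK (range1 m) L ⟩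
  sum (map (extensions (range1 m) L) (range1 m))     ≡⟨ sum-map-range1 m _ ⟩
  Σ< m (λ i → extensions (range1 m) L (suc i))       ≡⟨ Σ<-cong m (extensions≡inStrip L) ⟩
  Σ< m (λ i → inStrip m L (suc i))                   ∎

I+2*hits : ∀ m L → L ≤ m → I m (suc L) + 2 * Σ< m (λ i → hits L (suc i)) ≡ m * 3 ^ L
I+2*hits m L L≤m = begin
  I m (suc L) + 2 * H
    ≡⟨ cong₂ _+_ (I≡Σ<-inStrip m L) (double H) ⟩
  Σ< m (λ i → inStrip m L (suc i)) + (H + H)
    ≡⟨ cong (λ z → Σ< m (λ i → inStrip m L (suc i)) + (H + z)) (sym (Σ<-reverse m (hits L))) ⟩
  Σ< m (λ i → inStrip m L (suc i)) + (H + Σ< m (λ i → hits L (m ∸ i)))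
    ≡⟨ sym split ⟩
  Σ< m (λ i → inStrip m L (suc i) + hits L (suc i) + hits L (m ∸ i))
    ≡⟨ Σ<-cong m (λ i i<m → confined+hits+hits L (suc i) (m ∸ i) (L<width i<m)) ⟩
  Σ< m (λ _ → 3 ^ L)
    ≡⟨ Σ<-const m (3 ^ L) ⟩
  m * 3 ^ L ∎
  where
  H = Σ< m (λ i → hits L (suc i))
  split : Σ< m (λ i → inStrip m L (suc i) + hits L (suc i) + hits L (m ∸ i))
        ≡ Σ< m (λ i → inStrip m L (suc i)) + (H + Σ< m (λ i → hits L (m ∸ i)))
  split = begin
    Σ< m (λ i → inStrip m L (suc i) + hits L (suc i) + hits L (m ∸ i))
      ≡⟨ Σ<-distrib-+ m (λ i → inStrip m L (suc i) + hits L (suc i)) (λ i → hits L (m ∸ i)) ⟩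
    Σ< m (λ i → inStrip m L (suc i) + hits L (suc i)) + Σ< m (λ i → hits L (m ∸ i))
      ≡⟨ cong (_+ Σ< m (λ i → hits L (m ∸ i))) (Σ<-distrib-+ m (λ i → inStrip m L (suc i)) (λ i → hits L (suc i))) ⟩
    Σ< m (λ i → inStrip m L (suc i)) + H + Σ< m (λ i → hits L (m ∸ i))
      ≡⟨ +-assoc (Σ< m (λ i → inStrip m L (suc i))) H _ ⟩
    Σ< m (λ i → inStrip m L (suc i)) + (H + Σ< m (λ i → hits L (m ∸ i))) ∎
  double : ∀ x → 2 * x ≡ x + x
  double = solve-∀
  L<width : ∀ {i} → i < m → L < suc i + (m ∸ i)
  L<width i<m = subst (L <_) (sym (cong suc (m+[n∸m]≡n (<⇒≤ i<m)))) (s≤s L≤m)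

motzkinFrom : ℕ → ℕ → ℕ
motzkinFrom x k = count (motzOK x) (seqs steps k)

motzkinFrom-zero-suc : ∀ k → motzkinFrom 0 (suc k) ≡ motzkinFrom 0 k + motzkinFrom 1 k
motzkinFrom-zero-suc k = begin
  motzkinFrom 0 (suc k)
    ≡⟨ count-seqs-suc (motzOK 0) steps k ⟩
  motzkinFrom 1 k + (count (λ _ → false) (seqs steps k) + (motzkinFrom 0 k + 0))
    ≡⟨ cong (λ z → motzkinFrom 1 k + (z + (motzkinFrom 0 k + 0))) (count-false (seqs steps k)) ⟩
  motzkinFrom 1 k + (motzkinFrom 0 k + 0)
    ≡⟨ rearrange (motzkinFrom 1 k) (motzkinFrom 0 k) ⟩
  motzkinFrom 0 k + motzkinFrom 1 k ∎
  where
  rearrange : ∀ u f → u + (f + 0) ≡ f + u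
  rearrange = solve-∀

motzkinFrom-suc-suc : ∀ x k →
  motzkinFrom (suc x) (suc k) ≡ motzkinFrom x k + motzkinFrom (suc x) k + motzkinFrom (suc (suc x)) k
motzkinFrom-suc-suc x k = trans (count-seqs-suc (motzOK (suc x)) steps k)
  (rearrange (motzkinFrom (suc (suc x)) k) (motzkinFrom x k) (motzkinFrom (suc x) k))
  where
  rearrange : ∀ u d f → u + (d + (f + 0)) ≡ d + f + u
  rearrange = solve-∀

-- conv3 L a = Σ_{k<L} a k · 3^(L-1-k): a walk first touching 0 after k+1 steps has an arbitrary tail.
conv3 : ℕ → (ℕ → ℕ) → ℕ
conv3 zero    a = 0
conv3 (suc L) a = 3 * conv3 L a + a L

conv3-cong : ∀ L {a b : ℕ → ℕ} → (∀ k → a k ≡ b k) → conv3 L a ≡ conv3 L b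
conv3-cong zero    a≡b = refl
conv3-cong (suc L) a≡b = cong₂ (λ u v → 3 * u + v) (conv3-cong L a≡b) (a≡b L)

conv3-+ : ∀ L (a b : ℕ → ℕ) → conv3 L (λ k → a k + b k) ≡ conv3 L a + conv3 L b
conv3-+ zero    a b = refl
conv3-+ (suc L) a b rewrite conv3-+ L a b = rearrange (conv3 L a) (conv3 L b) (a L) (b L)
  where
  rearrange : ∀ x y u v → 3 * (x + y) + (u + v) ≡ 3 * x + u + (3 * y + v)
  rearrange = solve-∀

conv3-*ˡ : ∀ L c (a : ℕ → ℕ) → conv3 L (λ k → c * a k) ≡ c * conv3 L a
conv3-*ˡ zero    c a = sym (*-zeroʳ c)
conv3-*ˡ (suc L) c a rewrite conv3-*ˡ L c a = rearrange c (conv3 L a) (a L)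
  where
  rearrange : ∀ c x u → 3 * (c * x) + c * u ≡ c * (3 * x + u)
  rearrange = solve-∀

conv3-front : ∀ L (a : ℕ → ℕ) → conv3 (suc L) a ≡ a 0 * 3 ^ L + conv3 L (a ∘ suc)
conv3-front zero    a = rearrange (a 0)
  where
  rearrange : ∀ x → 3 * 0 + x ≡ x * 1 + 0
  rearrange = solve-∀
conv3-front (suc L) a rewrite conv3-front L a = rearrange (a 0) (3 ^ L) (conv3 L (a ∘ suc)) (a (suc L))
  where
  rearrange : ∀ x p q u → 3 * (x * p + q) + u ≡ x * (3 * p) + (3 * q + u)
  rearrange = solve-∀

conv3-powers : ∀ L → 3 * conv3 L (3 ^_) ≡ L * 3 ^ L
conv3-powers zero    = refl
conv3-powers (suc L) = begin
  3 * (3 * conv3 L (3 ^_) + 3 ^ L)    ≡⟨ *-distribˡ-+ 3 (3 * conv3 L (3 ^_)) (3 ^ L) ⟩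
  3 * (3 * conv3 L (3 ^_)) + 3 * 3 ^ L ≡⟨ cong (λ z → 3 * z + 3 * 3 ^ L) (conv3-powers L) ⟩
  3 * (L * 3 ^ L) + 3 * 3 ^ L          ≡⟨ rearrange L (3 ^ L) ⟩
  suc L * (3 * 3 ^ L)                  ∎
  where
  rearrange : ∀ L p → 3 * (L * p) + 3 * p ≡ suc L * (3 * p)
  rearrange = solve-∀

hits≡conv3 : ∀ L x → hits L (suc x) ≡ conv3 L (motzkinFrom x)
hits≡conv3 zero    x = refl
hits≡conv3 (suc L) zero = begin
  3 ^ L + hits L 1 + hits L 2
    ≡⟨ cong₂ (λ u v → 3 ^ L + u + v) (hits≡conv3 L 0) (hits≡conv3 L 1) ⟩
  3 ^ L + conv3 L (motzkinFrom 0) + conv3 L (motzkinFrom 1)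
    ≡⟨ +-assoc (3 ^ L) _ _ ⟩
  3 ^ L + (conv3 L (motzkinFrom 0) + conv3 L (motzkinFrom 1))
    ≡⟨ cong₂ _+_ (sym (*-identityˡ (3 ^ L))) (sym (conv3-+ L _ _)) ⟩
  1 * 3 ^ L + conv3 L (λ k → motzkinFrom 0 k + motzkinFrom 1 k)
    ≡⟨ cong (1 * 3 ^ L +_) (conv3-cong L (λ k → sym (motzkinFrom-zero-suc k))) ⟩
  1 * 3 ^ L + conv3 L (motzkinFrom 0 ∘ suc)
    ≡⟨ sym (conv3-front L (motzkinFrom 0)) ⟩
  conv3 (suc L) (motzkinFrom 0) ∎
hits≡conv3 (suc L) (suc x) = begin
  hits L (suc x) + hits L (suc (suc x)) + hits L (suc (suc (suc x)))
    ≡⟨ cong₂ _+_ (cong₂ _+_ (hits≡conv3 L x) (hits≡conv3 L (suc x))) (hits≡conv3 L (suc (suc x))) ⟩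
  conv3 L (motzkinFrom x) + conv3 L (motzkinFrom (suc x)) + conv3 L (motzkinFrom (suc (suc x)))
    ≡⟨ sym (trans (conv3-+ L (λ k → motzkinFrom x k + motzkinFrom (suc x) k) (motzkinFrom (suc (suc x))))
                  (cong (_+ conv3 L (motzkinFrom (suc (suc x)))) (conv3-+ L (motzkinFrom x) (motzkinFrom (suc x))))) ⟩
  conv3 L (λ k → motzkinFrom x k + motzkinFrom (suc x) k + motzkinFrom (suc (suc x)) k)
    ≡⟨ conv3-cong L (λ k → sym (motzkinFrom-suc-suc x k)) ⟩
  conv3 L (motzkinFrom (suc x) ∘ suc)
    ≡⟨ sym (conv3-front L (motzkinFrom (suc x))) ⟩
  conv3 (suc L) (motzkinFrom (suc x)) ∎

totalHits : ℕ → ℕ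
totalHits L = Σ< L (λ i → hits L (suc i))

totalHits-extend : ∀ d L → Σ< (d + L) (λ i → hits L (suc i)) ≡ totalHits L
totalHits-extend zero    L = refl
totalHits-extend (suc d) L = trans
  (cong₂ _+_ (totalHits-extend d L) (hits-vanish (s≤s (m≤n+m L d))))
  (+-identityʳ (totalHits L))

totalHits-suc : ∀ L → totalHits (suc L) + conv3 L Motzkin ≡ 3 * totalHits L + 3 ^ L
totalHits-suc L = begin
  totalHits (suc L) + conv3 L Motzkin
    ≡⟨ cong₂ _+_ (trans (Σ<-distrib-+ (suc L) (λ i → hits L i + hits L (suc i)) (hits L ∘ suc ∘ suc))
                        (cong (_+ Σ< (suc L) (hits L ∘ suc ∘ suc)) (Σ<-distrib-+ (suc L) (hits L) (hits L ∘ suc))))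
                 (sym (hits≡conv3 L 0)) ⟩
  Σ< (suc L) (hits L) + Σ< (suc L) (hits L ∘ suc) + Σ< (suc L) (hits L ∘ suc ∘ suc) + hits L 1
    ≡⟨ +-assoc (Σ< (suc L) (hits L) + Σ< (suc L) (hits L ∘ suc)) _ _ ⟩
  Σ< (suc L) (hits L) + Σ< (suc L) (hits L ∘ suc) + (Σ< (suc L) (hits L ∘ suc ∘ suc) + hits L 1)
    ≡⟨ cong₂ _+_ (cong₂ _+_ (Σ<-front L (hits L)) (totalHits-extend 1 L)) shifted ⟩
  3 ^ L + totalHits L + totalHits L + totalHits L
    ≡⟨ rearrange (3 ^ L) (totalHits L) ⟩
  3 * totalHits L + 3 ^ L ∎
  where
  shifted : Σ< (suc L) (hits L ∘ suc ∘ suc) + hits L 1 ≡ totalHits L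
  shifted = trans (+-comm _ (hits L 1))
    (trans (sym (Σ<-front (suc L) (hits L ∘ suc))) (totalHits-extend 2 L))
  rearrange : ∀ p t → p + t + t + t ≡ 3 * t + p
  rearrange = solve-∀

conv3² : ℕ → (ℕ → ℕ) → ℕ
conv3² L a = conv3 L (λ j → conv3 j a)

conv3²-front : ∀ L (a : ℕ → ℕ) → conv3² (suc L) a ≡ a 0 * conv3 L (3 ^_) + conv3² L (a ∘ suc)
conv3²-front L a = begin
  conv3 (suc L) (λ j → conv3 j a)
    ≡⟨ conv3-front L (λ j → conv3 j a) ⟩
  conv3 L (λ j → conv3 (suc j) a)
    ≡⟨ conv3-cong L (λ j → conv3-front j a) ⟩
  conv3 L (λ j → a 0 * 3 ^ j + conv3 j (a ∘ suc))
    ≡⟨ conv3-+ L _ _ ⟩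
  conv3 L (λ j → a 0 * 3 ^ j) + conv3² L (a ∘ suc)
    ≡⟨ cong (_+ conv3² L (a ∘ suc)) (conv3-*ˡ L (a 0) (3 ^_)) ⟩
  a 0 * conv3 L (3 ^_) + conv3² L (a ∘ suc) ∎

totalHits-closed : ∀ L → 3 * totalHits L + 3 * conv3² L Motzkin ≡ L * 3 ^ L
totalHits-closed zero    = refl
totalHits-closed (suc L) = begin
  3 * t′ + 3 * (3 * p + q)        ≡⟨ rearrange₁ t′ p q ⟩
  3 * (t′ + q) + 9 * p            ≡⟨ cong (λ z → 3 * z + 9 * p) (totalHits-suc L) ⟩
  3 * (3 * t + 3 ^ L) + 9 * p     ≡⟨ rearrange₂ t p (3 ^ L) ⟩
  3 * (3 * t + 3 * p) + 3 * 3 ^ L ≡⟨ cong (λ z → 3 * z + 3 * 3 ^ L) (totalHits-closed L) ⟩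
  3 * (L * 3 ^ L) + 3 * 3 ^ L     ≡⟨ rearrange₃ L (3 ^ L) ⟩
  suc L * (3 * 3 ^ L)             ∎
  where
  t = totalHits L
  t′ = totalHits (suc L)
  p = conv3² L Motzkin
  q = conv3 L Motzkin
  rearrange₁ : ∀ t′ p q → 3 * t′ + 3 * (3 * p + q) ≡ 3 * (t′ + q) + 9 * p
  rearrange₁ = solve-∀
  rearrange₂ : ∀ t p x → 3 * (3 * t + x) + 9 * p ≡ 3 * (3 * t + 3 * p) + 3 * x
  rearrange₂ = solve-∀
  rearrange₃ : ∀ L x → 3 * (L * x) + 3 * x ≡ suc L * (3 * x)
  rearrange₃ = solve-∀

weighted : ℕ → (ℕ → ℕ) → ℕ
weighted n a = Σ< (n ∸ 2) (λ k → (n ∸ k ∸ 2) * 3 ^ (n ∸ k ∸ 1) * a k)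

weighted≡9*conv3² : ∀ L (a : ℕ → ℕ) → weighted (suc L) a ≡ 9 * conv3² L a
weighted≡9*conv3² zero          a = refl
weighted≡9*conv3² (suc zero)    a = refl
weighted≡9*conv3² (suc (suc L)) a = begin
  weighted (3 + L) a
    ≡⟨ Σ<-front L _ ⟩
  suc L * (3 * (3 * 3 ^ L)) * a 0 + weighted (2 + L) (a ∘ suc)
    ≡⟨ cong (suc L * (3 * (3 * 3 ^ L)) * a 0 +_) (weighted≡9*conv3² (suc L) (a ∘ suc)) ⟩
  suc L * (3 * (3 * 3 ^ L)) * a 0 + 9 * r
    ≡⟨ rearrange₁ (suc L) (3 ^ L) (a 0) r ⟩
  3 * a 0 * (suc L * 3 ^ suc L) + 9 * r
    ≡⟨ cong (λ z → 3 * a 0 * z + 9 * r) (sym (conv3-powers (suc L))) ⟩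
  3 * a 0 * (3 * conv3 (suc L) (3 ^_)) + 9 * r
    ≡⟨ rearrange₂ (a 0) (conv3 (suc L) (3 ^_)) r ⟩
  9 * (a 0 * conv3 (suc L) (3 ^_) + r)
    ≡⟨ cong (9 *_) (sym (conv3²-front (suc L) a)) ⟩
  9 * conv3² (2 + L) a ∎
  where
  r = conv3² (suc L) (a ∘ suc)
  rearrange₁ : ∀ l p x r → l * (3 * (3 * p)) * x + 9 * r ≡ 3 * x * (l * (3 * p)) + 9 * r
  rearrange₁ = solve-∀
  rearrange₂ : ∀ x c r → 3 * x * (3 * c) + 9 * r ≡ 9 * (x * c + r)
  rearrange₂ = solve-∀

I-diagonal : ∀ L → I (suc L) (suc L) + 2 * totalHits L ≡ suc L * 3 ^ L
I-diagonal L = trans (cong (λ z → I (suc L) (suc L) + 2 * z) (sym (totalHits-extend 1 L)))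
  (I+2*hits (suc L) L (n≤1+n L))

I-diagonal-closed : ∀ L → 9 * I (suc L) (suc L) ≡ (suc L + 2) * 3 ^ suc L + 2 * (9 * conv3² L Motzkin)
I-diagonal-closed L = +-cancelʳ-≡ (18 * t) _ _ (begin
  9 * i + 18 * t                                    ≡⟨ rearrange₁ i t ⟩
  9 * (i + 2 * t)                                   ≡⟨ cong (9 *_) (I-diagonal L) ⟩
  9 * (suc L * x)                                   ≡⟨ rearrange₂ L x ⟩
  (suc L + 2) * (3 * x) + 6 * (L * x)               ≡⟨ cong (λ z → (suc L + 2) * (3 * x) + 6 * z) (sym (totalHits-closed L)) ⟩
  (suc L + 2) * (3 * x) + 6 * (3 * t + 3 * p)       ≡⟨ rearrange₃ (suc L + 2) x t p ⟩
  (suc L + 2) * (3 * x) + 2 * (9 * p) + 18 * t      ∎)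
  where
  i = I (suc L) (suc L)
  t = totalHits L
  p = conv3² L Motzkin
  x = 3 ^ L
  rearrange₁ : ∀ i t → 9 * i + 18 * t ≡ 9 * (i + 2 * t)
  rearrange₁ = solve-∀
  rearrange₂ : ∀ l x → 9 * (suc l * x) ≡ (suc l + 2) * (3 * x) + 6 * (l * x)
  rearrange₂ = solve-∀
  rearrange₃ : ∀ c x t p → c * (3 * x) + 6 * (3 * t + 3 * p) ≡ c * (3 * x) + 2 * (9 * p) + 18 * t
  rearrange₃ = solve-∀

corollary2p8 : (n : ℕ) → 1 ≤ n →
    9 * I n n ≡ (n + 2) * 3 ^ n
    + 2 * Σ< (n ∸ 2) (λ k → (n ∸ k ∸ 2) * 3 ^ (n ∸ k ∸ 1) * Motzkin k)
corollary2p8 (suc L) _ = begin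
  9 * I (suc L) (suc L)
    ≡⟨ I-diagonal-closed L ⟩
  (suc L + 2) * 3 ^ suc L + 2 * (9 * conv3² L Motzkin)
    ≡⟨ cong (λ z → (suc L + 2) * 3 ^ suc L + 2 * z) (sym (weighted≡9*conv3² L Motzkin)) ⟩
  (suc L + 2) * 3 ^ suc L + 2 * weighted (suc L) Motzkin ∎
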